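{- Let $d\ge 1$, $D=\binom{d+1}{2}$, and let $G=(V,E)$ be a finite graph (parallel edges allowed, no loops) with a bipartition $\{B,R\}$ of $V$. For every $F\subseteq E$, $\hat f(F)=r_f(f\circ F)$; i.e., the rank of $F$ in the polymatroid $(E,\hat f)$ equals the rank of $f\circ F$ in the matroid $\mathcal{M}_f(f\circ G)$.
   Context: For an edge set $F$ (of $G$ or of a graph on $V$), $V(F)$ is the set of vertices incident to edges of $F$ and $R(F)=R\cap V(F)$; $f(F)=D(|V(F)|-1)-|R(F)|$. $\hat f(F)=\min\sum_{i=1}^k f(F_i)$ over partitions $\{F_1,\dots,F_k\}$ of $F$ into nonempty subsets, with $\hat f(\emptyset)=0$. $f\circ G$ is the graph obtained from $G$ by replacing each edge $e$ by $f(e)$ parallel copies; $f\circ F$ is the set of all copies of edges of $F$. $\mathcal{M}_f(f\circ G)$ is the matroid on the edge set of $f\circ G$ in which $I$ is independent iff $|F'|\le f(F')$ for all nonempty $F'\subseteq I$; $r_f$ denotes its rank function. -}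

module Defs where

open import Data.Nat using (ℕ; zero; suc; _+_; _*_; _∸_; _≤_; _<_)
open import Data.Nat.Combinatorics using (_C_)
open import Data.Fin using (Fin; zero; suc; _≟_)
open import Data.Bool using (Bool; true; false; T; _∧_; _∨_; if_then_else_)
open import Data.Unit using (tt)
open import Data.Product using (Σ; ∃; _×_; _,_)
open import Relation.Nullary.Decidable using (⌊_⌋)
open import Relation.Binary.PropositionalEquality using (_≡_; _≢_)

D : ℕ → ℕ
D d = suc d C 2

Sub : ℕ → Set
Sub k = Fin k → Bool

count : ∀ {k} → Sub k → ℕ
count {zero} S = 0
count {suc k} S = (if S zero then 1 else 0) + count (λ i → S (suc i))

sumFin : ∀ {k} → (Fin k → ℕ) → ℕ
sumFin {zero} g = 0
sumFin {suc k} g = g zero + sumFin (λ i → g (suc i))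

anyFin : ∀ {k} → (Fin k → Bool) → Bool
anyFin {zero} g = false
anyFin {suc k} g = g zero ∨ anyFin (λ i → g (suc i))

_≡ᵇ_ : ∀ {k} → Fin k → Fin k → Bool
x ≡ᵇ y = ⌊ x ≟ y ⌋

-- A multigraph with vertex set Fin n and edge set Fin m; edge e joins u e and v e.
Loopless : ∀ {n m} → (Fin m → Fin n) → (Fin m → Fin n) → Set
Loopless u v = ∀ e → u e ≢ v e

-- {B,R} is a bipartition of G: R ⊆ V (B = V ∖ R) and every edge has exactly
-- one endpoint in R.
Bipartite : ∀ {n m} → (Fin m → Fin n) → (Fin m → Fin n) → Sub n → Set
Bipartite u v R = ∀ e → R (u e) ≢ R (v e)

module _ (d : ℕ) {n m : ℕ} (u v : Fin m → Fin n) (R : Sub n) where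

  VF : Sub m → Sub n
  VF F x = anyFin (λ e → F e ∧ ((x ≡ᵇ u e) ∨ (x ≡ᵇ v e)))

  RF : Sub m → Sub n
  RF F x = R x ∧ VF F x

  -- f(F) = D(|V(F)| - 1) - |R(F)|   (only ever applied to nonempty F, where,
  -- by bipartiteness, no truncation of ∸ occurs)
  fval : Sub m → ℕ
  fval F = D d * (count (VF F) ∸ 1) ∸ count (RF F)

  single : Fin m → Sub m
  single e e' = e' ≡ᵇ e

  mult : Fin m → ℕ
  mult e = fval (single e)

  -- subsets of the edge set of f∘G: copy i of edge e, i < f(e)
  CSub : Set
  CSub = (e : Fin m) → Sub (mult e)

  csize : CSub → ℕ
  csize I = sumFin (λ e → count (I e))

  under : CSub → Sub m
  under I e = anyFin (I e)

  _⊆c_ : CSub → CSub → Set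
  J ⊆c I = ∀ e i → T (J e i) → T (I e i)

  _⊆f∘_ : CSub → Sub m → Set
  I ⊆f∘ F = ∀ e i → T (I e i) → T (F e)

  Indep : CSub → Set
  Indep I = ∀ J → J ⊆c I → 0 < csize J → csize J ≤ fval (under J)

  IsRank : Sub m → ℕ → Set
  IsRank F r = (Σ CSub λ I → I ⊆f∘ F × Indep I × csize I ≡ r)
             × (∀ I → I ⊆f∘ F → Indep I → csize I ≤ r)

  -- a partition of F into k parts: a labelling of the edges of F by Fin k
  Labelling : Sub m → ℕ → Set
  Labelling F k = (e : Fin m) → T (F e) → Fin k

  memb : ∀ {k} (b : Bool) → (T b → Fin k) → Fin k → Bool
  memb true g j = g tt ≡ᵇ j
  memb false g j = false

  part : ∀ {F k} → Labelling F k → Fin k → Sub m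
  part {F} p j e = memb (F e) (p e) j

  AllNonempty : ∀ {F k} → Labelling F k → Set
  AllNonempty {F} p = ∀ j → ∃ λ e → Σ (T (F e)) λ h → p e h ≡ j

  partSum : ∀ {F k} → Labelling F k → ℕ
  partSum {F} {k} p = sumFin (λ j → fval (part {F} {k} p j))

  -- f̂(F) = v  (minimum over partitions into nonempty parts; f̂(∅) = 0 via k = 0)
  IsFhat : Sub m → ℕ → Set
  IsFhat F val = (Σ ℕ λ k → Σ (Labelling F k) λ p → AllNonempty {F} p × partSum {F} p ≡ val)
               × (∀ k (p : Labelling F k) → AllNonempty {F} p → val ≤ partSum {F} p)

-- Both sides equal the largest total weight y(F) of an integer vector y supported on F
-- that is feasible, i.e. y(S) ≤ f(S) for every edge set S. A set of copies is
-- independent exactly when its vector of copy counts is feasible, which gives the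
-- matroid side; every partition of F costs at least y(F), which gives f̂(F) ≥ y(F).
-- For the converse, f is nondecreasing and submodular on pairs of edge sets with a
-- common edge: on nonempty S, f(S) + D = (D - 1)|R(S)| + D|B(S)|, a nonnegative
-- combination of vertex counts. So tight sets (y(S) = f(S)) sharing an edge have a
-- tight union. For a feasible y that cannot be raised anywhere on F, every edge of F
-- lies in a tight subset of F, the maximal such subsets partition F, and this
-- partition costs exactly y(F).

module Submission where

open import Defs
open import Data.Nat using (ℕ; zero; suc; _+_; _*_; _∸_; _≤_; _<_; _<ᵇ_; z≤n; s≤s; _≤?_)
open import Data.Nat.Properties hiding (_≟_)
import Data.Nat.Properties as ℕ
open import Data.Nat.Tactic.RingSolver using (solve-∀)
open import Algebra.Properties.CommutativeSemigroup +-commutativeSemigroup using (interchange)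
open import Data.Nat.Combinatorics using (_C_; nC1≡n; nCk+nC[k+1]≡[n+1]C[k+1])
open import Algebra.Properties.CommutativeMonoid.Sum +-0-commutativeMonoid
  using (sum; ∑-distrib-+; ∑-comm; sum-remove)
open import Data.Fin using (Fin; zero; suc; toℕ; punchIn; punchOut; _≟_)
open import Data.Fin.Properties
  using (any?; all?; punchInᵢ≢i; punchIn-punchOut; punchIn-injective)
open import Data.Fin.Subset.Properties using (anySubset?)
open import Data.Vec using (lookup; tabulate)
open import Data.Vec.Properties using (lookup∘tabulate)
open import Data.Bool using (Bool; true; false; T; not; _∧_; _∨_; if_then_else_)
open import Data.Bool.Properties using (T?)
import Data.Bool.Properties as Bool
open import Data.Maybe using (Maybe; just; nothing)
import Data.Maybe as Maybe
open import Data.Maybe.Properties using (just-injective)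
open import Data.List using (List; []; _∷_; allFin)
open import Data.List.Relation.Unary.Any using (here; there)
open import Data.List.Membership.Propositional using (_∈_)
open import Data.List.Membership.Propositional.Properties using (∈-allFin)
open import Data.Unit using (tt)
open import Data.Empty using (⊥-elim)
open import Data.Product using (Σ; ∃; ∃₂; _×_; _,_; proj₁; proj₂)
open import Data.Sum using (_⊎_; inj₁; inj₂)
open import Function using (_∘_)
open import Relation.Nullary using (¬_; Dec; yes; no; contradiction)
open import Relation.Nullary.Decidable using (toWitness; decidable-stable; ¬?; _×-dec_; _→-dec_)
open import Relation.Binary.PropositionalEquality

T-ext : ∀ {a b} → (T a → T b) → (T b → T a) → a ≡ b
T-ext {false} {false} _ _ = refl
T-ext {false} {true}  _ g = ⊥-elim (g tt)
T-ext {true}  {false} f _ = ⊥-elim (f tt)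
T-ext {true}  {true}  _ _ = refl

¬T⇒≡false : ∀ {a} → ¬ T a → a ≡ false
¬T⇒≡false {false} _ = refl
¬T⇒≡false {true}  h = ⊥-elim (h tt)

≡ᵇ-refl : ∀ {k} (i : Fin k) → (i ≡ᵇ i) ≡ true
≡ᵇ-refl i with i ≟ i
... | yes _  = refl
... | no i≢i = contradiction refl i≢i

≡ᵇ-≢ : ∀ {k} {i j : Fin k} → i ≢ j → (i ≡ᵇ j) ≡ false
≡ᵇ-≢ {i = i} {j} i≢j with i ≟ j
... | yes i≡j = contradiction i≡j i≢j
... | no _    = refl

module _ {k : ℕ} where

  infixr 6 _∩_
  infixr 5 _∪_
  infix 4 _⊆_ _≐_

  _⊆_ _≐_ : Sub k → Sub k → Set
  S ⊆ S' = ∀ i → T (S i) → T (S' i)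
  S ≐ S' = ∀ i → S i ≡ S' i

  _∪_ _∩_ : Sub k → Sub k → Sub k
  (S ∪ S') i = S i ∨ S' i
  (S ∩ S') i = S i ∧ S' i

  ∁ : Sub k → Sub k
  ∁ S i = not (S i)

  Empty : Sub k → Set
  Empty S = ∀ i → S i ≡ false

  ⊆-antisym : ∀ {S S'} → S ⊆ S' → S' ⊆ S → S ≐ S'
  ⊆-antisym S⊆S' S'⊆S i = T-ext (S⊆S' i) (S'⊆S i)

  ∪-introˡ : ∀ {S S'} → S ⊆ S ∪ S'
  ∪-introˡ {S} i t with S i
  ... | true = tt

  ∪-introʳ : ∀ {S S'} → S' ⊆ S ∪ S'
  ∪-introʳ {S} i t with S i
  ... | true  = tt
  ... | false = t

  ∪-elim : ∀ {S S' i} → T ((S ∪ S') i) → T (S i) ⊎ T (S' i)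
  ∪-elim {S} {S'} {i} t with S i | S' i
  ... | true  | _    = inj₁ tt
  ... | false | true = inj₂ tt

  ∪-least : ∀ {S S' M} → S ⊆ M → S' ⊆ M → S ∪ S' ⊆ M
  ∪-least {S} {S'} S⊆M S'⊆M i t with ∪-elim {S} {S'} t
  ... | inj₁ s  = S⊆M i s
  ... | inj₂ s' = S'⊆M i s'

  ∩-elimˡ : ∀ {S S'} → S ∩ S' ⊆ S
  ∩-elimˡ {S} i t with S i
  ... | true = tt

  ∩-elimʳ : ∀ {S S'} → S ∩ S' ⊆ S'
  ∩-elimʳ {S} i t with S i
  ... | true = t

  ∩-intro : ∀ {S S' i} → T (S i) → T (S' i) → T ((S ∩ S') i)
  ∩-intro {S} {S'} {i} s s' with S i | S' i
  ... | true | true = tt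

  ∩-monoʳ : ∀ {X S S'} → S ⊆ S' → X ∩ S ⊆ X ∩ S'
  ∩-monoʳ {X} {S} {S'} S⊆S' i t =
    ∩-intro {X} {S'} (∩-elimˡ {X} {S} i t) (S⊆S' i (∩-elimʳ {X} {S} i t))

  ∩-distribˡ-∪ : ∀ {X A S S'} → A ⊆ S ∪ S' → X ∩ A ⊆ (X ∩ S) ∪ (X ∩ S')
  ∩-distribˡ-∪ {X} {A} {S} {S'} A⊆ i t with ∪-elim {S} {S'} (A⊆ i (∩-elimʳ {X} {A} i t))
  ... | inj₁ s  = ∪-introˡ {X ∩ S} {X ∩ S'} i (∩-intro {X} {S} (∩-elimˡ {X} {A} i t) s)
  ... | inj₂ s' = ∪-introʳ {X ∩ S} {X ∩ S'} i (∩-intro {X} {S'} (∩-elimˡ {X} {A} i t) s')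

  ≐⇒⊆ : ∀ {S S'} → S ≐ S' → S ⊆ S'
  ≐⇒⊆ eq i = subst T (eq i)

  ≐-sym : ∀ {S S'} → S ≐ S' → S' ≐ S
  ≐-sym eq i = sym (eq i)

  ∩-greatest : ∀ {M S S'} → M ⊆ S → M ⊆ S' → M ⊆ S ∩ S'
  ∩-greatest {S = S} {S'} M⊆S M⊆S' i t = ∩-intro {S} {S'} (M⊆S i t) (M⊆S' i t)

sumFin≡sum : ∀ {k} (g : Fin k → ℕ) → sumFin g ≡ sum g
sumFin≡sum {zero}  g = refl
sumFin≡sum {suc k} g = cong (g zero +_) (sumFin≡sum (g ∘ suc))

sumFin-cong : ∀ {k} {g h : Fin k → ℕ} → (∀ i → g i ≡ h i) → sumFin g ≡ sumFin h
sumFin-cong {zero}  eq = refl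
sumFin-cong {suc k} eq = cong₂ _+_ (eq zero) (sumFin-cong (eq ∘ suc))

sumFin-mono : ∀ {k} {g h : Fin k → ℕ} → (∀ i → g i ≤ h i) → sumFin g ≤ sumFin h
sumFin-mono {zero}  le = z≤n
sumFin-mono {suc k} le = +-mono-≤ (le zero) (sumFin-mono (le ∘ suc))

sumFin-zero : ∀ {k} {g : Fin k → ℕ} → (∀ i → g i ≡ 0) → sumFin g ≡ 0
sumFin-zero {zero}  eq = refl
sumFin-zero {suc k} eq rewrite eq zero = sumFin-zero (eq ∘ suc)

sumFin-distrib-+ : ∀ {k} (g h : Fin k → ℕ) → sumFin (λ i → g i + h i) ≡ sumFin g + sumFin h
sumFin-distrib-+ g h = begin
  sumFin (λ i → g i + h i)  ≡⟨ sumFin≡sum (λ i → g i + h i) ⟩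
  sum (λ i → g i + h i)     ≡⟨ ∑-distrib-+ g h ⟩
  sum g + sum h             ≡⟨ sym (cong₂ _+_ (sumFin≡sum g) (sumFin≡sum h)) ⟩
  sumFin g + sumFin h       ∎
  where open ≡-Reasoning

sumFin-comm : ∀ {k l} (g : Fin k → Fin l → ℕ) →
              sumFin (λ i → sumFin (g i)) ≡ sumFin (λ j → sumFin (λ i → g i j))
sumFin-comm g = begin
  sumFin (λ i → sumFin (g i))           ≡⟨ sumFin-cong (λ i → sumFin≡sum (g i)) ⟩
  sumFin (λ i → sum (g i))              ≡⟨ sumFin≡sum (λ i → sum (g i)) ⟩
  sum (λ i → sum (g i))                 ≡⟨ ∑-comm g ⟩
  sum (λ j → sum (λ i → g i j))         ≡⟨ sym (sumFin≡sum (λ j → sum (λ i → g i j))) ⟩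
  sumFin (λ j → sum (λ i → g i j))      ≡⟨ sym (sumFin-cong (λ j → sumFin≡sum (λ i → g i j))) ⟩
  sumFin (λ j → sumFin (λ i → g i j))   ∎
  where open ≡-Reasoning

sumFin-remove : ∀ {k} (i : Fin (suc k)) (g : Fin (suc k) → ℕ) →
                sumFin g ≡ g i + sumFin (g ∘ punchIn i)
sumFin-remove i g = begin
  sumFin g                      ≡⟨ sumFin≡sum g ⟩
  sum g                         ≡⟨ sum-remove g ⟩
  g i + sum (g ∘ punchIn i)     ≡⟨ sym (cong (g i +_) (sumFin≡sum (g ∘ punchIn i))) ⟩
  g i + sumFin (g ∘ punchIn i)  ∎
  where open ≡-Reasoning

sumFin-at : ∀ {k} {g : Fin k → ℕ} (i : Fin k) → (∀ j → j ≢ i → g j ≡ 0) → sumFin g ≡ g i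
sumFin-at {suc k} {g} i rest = begin
  sumFin g                      ≡⟨ sumFin-remove i g ⟩
  g i + sumFin (g ∘ punchIn i)  ≡⟨ cong (g i +_) (sumFin-zero (λ j → rest _ (punchInᵢ≢i i j))) ⟩
  g i + 0                       ≡⟨ +-identityʳ (g i) ⟩
  g i                           ∎
  where open ≡-Reasoning

sumFin-member : ∀ {k} {g : Fin k → ℕ} (i : Fin k) → g i ≤ sumFin g
sumFin-member {suc k} {g} i = subst (g i ≤_) (sym (sumFin-remove i g)) (m≤m+n (g i) _)

≤-squeeze : ∀ {a b A B} → a ≤ A → b ≤ B → A + B ≤ a + b → a ≡ A
≤-squeeze a≤A b≤B A+B≤a+b with m≤n⇒m<n∨m≡n a≤A
... | inj₂ a≡A = a≡A
... | inj₁ a<A = contradiction A+B≤a+b (<⇒≱ (+-mono-<-≤ a<A b≤B))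

weight : ∀ {k} → (Fin k → ℕ) → Sub k → ℕ
weight w S = sumFin (λ i → if S i then w i else 0)

SupportedOn : ∀ {k} → (Fin k → ℕ) → Sub k → Set
SupportedOn w F = ∀ i → F i ≡ false → w i ≡ 0

module _ {k : ℕ} (w : Fin k → ℕ) where

  private
    term : Sub k → Fin k → ℕ
    term S i = if S i then w i else 0

  weight-cong : ∀ {S S'} → S ≐ S' → weight w S ≡ weight w S'
  weight-cong eq = sumFin-cong (λ i → cong (λ b → if b then w i else 0) (eq i))

  weight-mono : ∀ {S S'} → S ⊆ S' → weight w S ≤ weight w S'
  weight-mono {S} {S'} S⊆S' = sumFin-mono pointwise
    where
    pointwise : ∀ i → term S i ≤ term S' i
    pointwise i with S i | S' i | S⊆S' i
    ... | false | _     | _ = z≤n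
    ... | true  | true  | _ = ≤-refl
    ... | true  | false | s = ⊥-elim (s tt)

  weight-empty : ∀ {S} → Empty S → weight w S ≡ 0
  weight-empty S-empty = sumFin-zero (λ i → cong (λ b → if b then w i else 0) (S-empty i))

  weight-member : ∀ {S} i → T (S i) → w i ≤ weight w S
  weight-member {S} i t with S i | sumFin-member {g = term S} i
  ... | true | le = le

  weight-modular : ∀ S S' → weight w (S ∪ S') + weight w (S ∩ S') ≡ weight w S + weight w S'
  weight-modular S S' = begin
    weight w (S ∪ S') + weight w (S ∩ S')            ≡⟨ sumFin-distrib-+ (term (S ∪ S')) (term (S ∩ S')) ⟨
    sumFin (λ i → term (S ∪ S') i + term (S ∩ S') i) ≡⟨ sumFin-cong pointwise ⟩
    sumFin (λ i → term S i + term S' i)              ≡⟨ sumFin-distrib-+ (term S) (term S') ⟩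
    weight w S + weight w S'                         ∎
    where
    open ≡-Reasoning
    pointwise : ∀ i → term (S ∪ S') i + term (S ∩ S') i ≡ term S i + term S' i
    pointwise i with S i | S' i
    ... | true  | true  = refl
    ... | true  | false = refl
    ... | false | true  = +-identityʳ (w i)
    ... | false | false = refl

  weight-split : ∀ P S → weight w S ≡ weight w (P ∩ S) + weight w (∁ P ∩ S)
  weight-split P S = trans (sumFin-cong pointwise) (sumFin-distrib-+ (term (P ∩ S)) (term (∁ P ∩ S)))
    where
    pointwise : ∀ i → term S i ≡ term (P ∩ S) i + term (∁ P ∩ S) i
    pointwise i with P i | S i
    ... | true  | true  = sym (+-identityʳ (w i))
    ... | true  | false = refl
    ... | false | true  = refl
    ... | false | false = refl

  weight-+ : ∀ (w' : Fin k → ℕ) S → weight (λ i → w i + w' i) S ≡ weight w S + weight w' S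
  weight-+ w' S = trans (sumFin-cong pointwise) (sumFin-distrib-+ (term S) (λ i → if S i then w' i else 0))
    where
    pointwise : ∀ i → (if S i then w i + w' i else 0) ≡ term S i + (if S i then w' i else 0)
    pointwise i with S i
    ... | true  = refl
    ... | false = refl

  module _ {F : Sub k} (supported : SupportedOn w F) where

    weight-∩-support : ∀ S → weight w (S ∩ F) ≡ weight w S
    weight-∩-support S = sumFin-cong pointwise
      where
      pointwise : ∀ i → (if (S ∩ F) i then w i else 0) ≡ (if S i then w i else 0)
      pointwise i with S i | F i in Fi
      ... | false | _     = refl
      ... | true  | true  = refl
      ... | true  | false = sym (supported i Fi)

    sumFin≡weight-support : sumFin w ≡ weight w F
    sumFin≡weight-support = sumFin-cong pointwise
      where
      pointwise : ∀ i → w i ≡ (if F i then w i else 0)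
      pointwise i with F i in Fi
      ... | true  = refl
      ... | false = supported i Fi

count≡weight : ∀ {k} (S : Sub k) → count S ≡ weight (λ _ → 1) S
count≡weight {zero}  S = refl
count≡weight {suc k} S = cong ((if S zero then 1 else 0) +_) (count≡weight (S ∘ suc))

module _ {k : ℕ} where

  count-cong : ∀ {S S' : Sub k} → S ≐ S' → count S ≡ count S'
  count-cong {S} {S'} eq rewrite count≡weight S | count≡weight S' = weight-cong _ eq

  count-mono : ∀ {S S' : Sub k} → S ⊆ S' → count S ≤ count S'
  count-mono {S} {S'} S⊆S' rewrite count≡weight S | count≡weight S' = weight-mono _ S⊆S'

  count-empty : ∀ {S : Sub k} → Empty S → count S ≡ 0
  count-empty {S} S-empty rewrite count≡weight S = weight-empty _ S-empty

  count-member : ∀ {S : Sub k} i → T (S i) → 1 ≤ count S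
  count-member {S} i t rewrite count≡weight S = weight-member _ i t

  count-modular : ∀ (S S' : Sub k) → count (S ∪ S') + count (S ∩ S') ≡ count S + count S'
  count-modular S S'
    rewrite count≡weight (S ∪ S') | count≡weight (S ∩ S') | count≡weight S | count≡weight S'
    = weight-modular _ S S'

  count-split : ∀ (P S : Sub k) → count S ≡ count (P ∩ S) + count (∁ P ∩ S)
  count-split P S rewrite count≡weight S | count≡weight (P ∩ S) | count≡weight (∁ P ∩ S)
    = weight-split _ P S

  count-submodular : ∀ {A B S S' : Sub k} → A ⊆ S ∪ S' → B ⊆ S ∩ S' →
                     count A + count B ≤ count S + count S'
  count-submodular {A} {B} {S} {S'} A⊆ B⊆ = begin
    count A + count B                  ≤⟨ +-mono-≤ (count-mono A⊆) (count-mono B⊆) ⟩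
    count (S ∪ S') + count (S ∩ S')    ≡⟨ count-modular S S' ⟩
    count S + count S'                 ∎
    where open ≤-Reasoning

count-prefix : ∀ {k} c → c ≤ k → count {k} (λ i → toℕ i <ᵇ c) ≡ c
count-prefix {k}      zero    _         = count-empty {k} (λ _ → refl)
count-prefix {suc k} (suc c) (s≤s c≤k) = cong suc (count-prefix c c≤k)

∃Sub? : ∀ {k} {P : Sub k → Set} → (∀ S → Dec (P S)) →
        (∀ {S S'} → S ≐ S' → P S → P S') → Dec (∃ P)
∃Sub? P? P-resp with anySubset? (P? ∘ lookup)
... | yes (v , Pv) = yes (lookup v , Pv)
... | no ∄ = no λ (S , PS) → ∄ (tabulate S , P-resp (≐-sym (lookup∘tabulate S)) PS)

module _ {k : ℕ} {P : Sub k → Set} (P? : ∀ S → Dec (P S))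
         (P-resp : ∀ {S S'} → S ≐ S' → P S → P S') where

  all-or-counterexample : (∀ S → P S) ⊎ ∃ λ S → ¬ P S
  all-or-counterexample with ∃Sub? (¬? ∘ P?) (λ eq ¬PS PS' → ¬PS (P-resp (≐-sym eq) PS'))
  ... | yes counterexample = inj₂ counterexample
  ... | no ∄ = inj₁ λ S → decidable-stable (P? S) (λ ¬PS → ∄ (S , ¬PS))

  module _ (P-∪ : ∀ {S S'} → P S → P S' → P (S ∪ S')) where

    private
      witness? : ∀ i → Dec (∃ λ V → P V × T (V i))
      witness? i = ∃Sub? (λ V → P? V ×-dec T? (V i))
                         (λ eq (PV , Vi) → P-resp eq PV , subst T (eq i) Vi)

      absorb : ∀ (l : List (Fin k)) {U} → P U →
               ∃ λ M → P M × U ⊆ M × (∀ i → i ∈ l → ∀ V → P V → T (V i) → T (M i))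
      absorb [] {U} PU = U , PU , (λ _ t → t) , λ _ ()
      absorb (i ∷ l) {U} PU with witness? i
      ... | no ∄ =
        let M , PM , U⊆M , absorbs = absorb l PU
        in M , PM , U⊆M , λ where
             _ (here refl) V PV Vi → ⊥-elim (∄ (V , PV , Vi))
             j (there j∈l) → absorbs j j∈l
      ... | yes (W , PW , Wi) =
        let M , PM , U∪W⊆M , absorbs = absorb l (P-∪ PU PW)
        in M , PM , (λ j t → U∪W⊆M j (∪-introˡ {S = U} {W} j t)) , λ where
             _ (here refl) _ _ _ → U∪W⊆M i (∪-introʳ {S = U} {W} i Wi)
             j (there j∈l) → absorbs j j∈l

    greatest : ∀ {U} → P U → ∃ λ M → P M × (∀ V → P V → V ⊆ M)
    greatest PU =
      let M , PM , _ , absorbs = absorb (allFin k) PU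
      in M , PM , λ V PV i Vi → absorbs i (∈-allFin i) V PV Vi

first : ∀ {k} → Sub k → Maybe (Fin k)
first {zero}  S = nothing
first {suc k} S = if S zero then just zero else Maybe.map suc (first (S ∘ suc))

first-cong : ∀ {k} {S S' : Sub k} → S ≐ S' → first S ≡ first S'
first-cong {zero}          eq = refl
first-cong {suc k} {S} {S'} eq
  rewrite eq zero | first-cong {S = S ∘ suc} {S' ∘ suc} (eq ∘ suc) = refl

first-member : ∀ {k} (S : Sub k) {i} → first S ≡ just i → T (S i)
first-member {suc k} S eq with S zero in S0
first-member {suc k} S refl | true = subst T (sym S0) tt
... | false with first (S ∘ suc) in first-tail
first-member {suc k} S refl | false | just j = first-member (S ∘ suc) first-tail

first-nonempty : ∀ {k} (S : Sub k) {i} → T (S i) → ∃ λ j → first S ≡ just j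
first-nonempty {suc k} S {i} t with S zero in S0
... | true = zero , refl
... | false with i | first (S ∘ suc) in first-tail
... | zero  | _      = ⊥-elim (subst T S0 t)
... | suc i | just j = suc j , refl
... | suc i | nothing with first-nonempty (S ∘ suc) t
... | _ , first-tail' = contradiction (trans (sym first-tail) first-tail') λ ()

nonempty-or-empty : ∀ {k} (S : Sub k) → (∃ λ i → T (S i)) ⊎ Empty S
nonempty-or-empty S with any? (λ i → T? (S i))
... | yes nonempty = inj₁ nonempty
... | no ∄ = inj₂ λ i → ¬T⇒≡false λ t → ∄ (i , t)

empty? : ∀ {k} (S : Sub k) → Dec (Empty S)
empty? S = all? (λ i → S i Bool.≟ false)

anyFin-intro : ∀ {k} (g : Fin k → Bool) i → T (g i) → T (anyFin g)
anyFin-intro g zero    t with g zero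
... | true = t
anyFin-intro g (suc i) t with g zero
... | true  = tt
... | false = anyFin-intro (g ∘ suc) i t

anyFin-elim : ∀ {k} (g : Fin k → Bool) → T (anyFin g) → ∃ λ i → T (g i)
anyFin-elim {suc k} g t with g zero in g0
... | true  = zero , subst T (sym g0) tt
... | false = let i , gi = anyFin-elim (g ∘ suc) t in suc i , gi

-- With D = c + 1, for an edge set with r red and b + 1 blue vertices: at least one
-- blue vertex makes both truncated subtractions in f exact, and f + D is affine.
fval-shift-arith : ∀ c r b → suc c * (r + suc b ∸ 1) ∸ r + suc c ≡ c * r + suc c * suc b
fval-shift-arith c r b = begin
  suc c * (r + suc b ∸ 1) ∸ r + suc c      ≡⟨ cong (λ s → suc c * (s ∸ 1) ∸ r + suc c) (+-suc r b) ⟩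
  suc c * (r + b) ∸ r + suc c              ≡⟨ cong (λ s → s ∸ r + suc c) (expand c r b) ⟩
  r + (b + c * (r + b)) ∸ r + suc c        ≡⟨ cong (_+ suc c) (m+n∸m≡n r (b + c * (r + b))) ⟩
  b + c * (r + b) + suc c                  ≡⟨ regroup c r b ⟩
  c * r + suc c * suc b                    ∎
  where
  open ≡-Reasoning
  expand : ∀ c r b → suc c * (r + b) ≡ r + (b + c * (r + b))
  expand = solve-∀
  regroup : ∀ c r b → b + c * (r + b) + suc c ≡ c * r + suc c * suc b
  regroup = solve-∀

module EdgeSets (d : ℕ) {n m : ℕ} (u v : Fin m → Fin n) (R : Sub n) where

  V : Sub m → Sub n
  V = VF d u v R

  f : Sub m → ℕ
  f = fval d u v R

  Feasible : (Fin m → ℕ) → Set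
  Feasible y = ∀ S → weight y S ≤ f S

  Tight : (Fin m → ℕ) → Sub m → Set
  Tight y S = weight y S ≡ f S

  incident : Fin n → Sub m
  incident x e = (x ≡ᵇ u e) ∨ (x ≡ᵇ v e)

  VF-intro : ∀ {S x} e → T (S e) → T (incident x e) → T (V S x)
  VF-intro {S} {x} e Se xe = anyFin-intro (S ∩ incident x) e (∩-intro {S = S} {S' = incident x} Se xe)

  VF-elim : ∀ {S x} → T (V S x) → ∃ λ e → T (S e) × T (incident x e)
  VF-elim {S} {x} t =
    let e , t' = anyFin-elim (S ∩ incident x) t
    in e , ∩-elimˡ {S = S} {S' = incident x} e t' , ∩-elimʳ {S = S} {S' = incident x} e t'

  VF-mono : ∀ {S S'} → S ⊆ S' → V S ⊆ V S'
  VF-mono {S} {S'} S⊆S' x t = let e , Se , xe = VF-elim {S} {x} t in VF-intro {S'} {x} e (S⊆S' e Se) xe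

  VF-cong : ∀ {S S'} → S ≐ S' → V S ≐ V S'
  VF-cong eq = ⊆-antisym (VF-mono (≐⇒⊆ eq)) (VF-mono (≐⇒⊆ (≐-sym eq)))

  VF-∪ : ∀ S S' → V (S ∪ S') ⊆ V S ∪ V S'
  VF-∪ S S' x t with VF-elim {S ∪ S'} {x} t
  ... | e , S∪S'e , xe with ∪-elim {S = S} {S' = S'} S∪S'e
  ... | inj₁ Se  = ∪-introˡ {S = V S} {S' = V S'} x (VF-intro {S} {x} e Se xe)
  ... | inj₂ S'e = ∪-introʳ {S = V S} {S' = V S'} x (VF-intro {S'} {x} e S'e xe)

  VF-∩ : ∀ S S' → V (S ∩ S') ⊆ V S ∩ V S'
  VF-∩ S S' = ∩-greatest {M = V (S ∩ S')} (VF-mono (∩-elimˡ {S = S})) (VF-mono (∩-elimʳ {S = S}))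

  VF-empty : ∀ {S} → Empty S → Empty (V S)
  VF-empty {S} S-empty x = ¬T⇒≡false λ t → let e , Se , _ = VF-elim {S} {x} t in subst T (S-empty e) Se

  VF-endpoints : ∀ {S} e → T (S e) → T (V S (u e)) × T (V S (v e))
  VF-endpoints {S} e Se =
      VF-intro {S} {u e} e Se (subst (λ b → T (b ∨ (u e ≡ᵇ v e))) (sym (≡ᵇ-refl (u e))) tt)
    , VF-intro {S} {v e} e Se (subst (λ b → T ((v e ≡ᵇ u e) ∨ b)) (sym (≡ᵇ-refl (v e)))
                                     (∪-introʳ {S = λ _ → v e ≡ᵇ u e} {S' = λ _ → true} e tt))

  fval-cong : ∀ {S S'} → S ≐ S' → f S ≡ f S'
  fval-cong eq = cong₂ (λ |V| |R| → D d * (|V| ∸ 1) ∸ |R|)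
                       (count-cong (VF-cong eq)) (count-cong (λ x → cong (R x ∧_) (VF-cong eq x)))

  fval-empty : ∀ {S} → Empty S → f S ≡ 0
  fval-empty {S} S-empty = begin
    D d * (count (V S) ∸ 1) ∸ count (R ∩ V S)  ≡⟨ cong (λ |V| → D d * (|V| ∸ 1) ∸ count (R ∩ V S))
                                                       (count-empty (VF-empty S-empty)) ⟩
    D d * 0 ∸ count (R ∩ V S)                  ≡⟨ cong (_∸ count (R ∩ V S)) (*-zeroʳ (D d)) ⟩
    0 ∸ count (R ∩ V S)                        ≡⟨ 0∸n≡0 (count (R ∩ V S)) ⟩
    0                                          ∎
    where open ≡-Reasoning

  module Submodularity (c : ℕ) (D≡ : D d ≡ suc c) (bipartite : Bipartite u v R) where

    ψ : Sub m → ℕ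
    ψ S = c * count (R ∩ V S) + suc c * count (∁ R ∩ V S)

    blue-nonempty : ∀ {S} e → T (S e) → 1 ≤ count (∁ R ∩ V S)
    blue-nonempty {S} e Se with R (u e) in Ru | R (v e) in Rv | bipartite e
    ... | true  | true  | ≢ = contradiction refl ≢
    ... | false | false | ≢ = contradiction refl ≢
    ... | false | true  | _ =
      count-member (u e) (∩-intro {S = ∁ R} {S' = V S} (subst (T ∘ not) (sym Ru) tt)
                                                       (proj₁ (VF-endpoints e Se)))
    ... | true  | false | _ =
      count-member (v e) (∩-intro {S = ∁ R} {S' = V S} (subst (T ∘ not) (sym Rv) tt)
                                                       (proj₂ (VF-endpoints e Se)))

    fval-shift : ∀ {S} e → T (S e) → f S + suc c ≡ ψ S
    fval-shift {S} e Se with count (∁ R ∩ V S) in blue | blue-nonempty {S} e Se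
    ... | suc b | _ = begin
      D d * (count (V S) ∸ 1) ∸ r + suc c   ≡⟨ cong₂ (λ D' |V| → D' * (|V| ∸ 1) ∸ r + suc c) D≡ |V|≡ ⟩
      suc c * (r + suc b ∸ 1) ∸ r + suc c   ≡⟨ fval-shift-arith c r b ⟩
      c * r + suc c * suc b                 ∎
      where
      open ≡-Reasoning
      r = count (R ∩ V S)
      |V|≡ : count (V S) ≡ r + suc b
      |V|≡ = trans (count-split R (V S)) (cong (r +_) blue)

    ψ-mono : ∀ {S S'} → S ⊆ S' → ψ S ≤ ψ S'
    ψ-mono {S} {S'} S⊆S' =
      +-mono-≤ (*-monoʳ-≤ c (count-mono (∩-monoʳ {X = R} {V S} {V S'} (VF-mono S⊆S'))))
               (*-monoʳ-≤ (suc c) (count-mono (∩-monoʳ {X = ∁ R} {V S} {V S'} (VF-mono S⊆S'))))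

    ψ-submodular : ∀ S S' → ψ (S ∪ S') + ψ (S ∩ S') ≤ ψ S + ψ S'
    ψ-submodular S S' = subst₂ _≤_ (regroup c (suc c) _ _ _ _) (regroup c (suc c) _ _ _ _)
      (+-mono-≤ (*-monoʳ-≤ c (along R)) (*-monoʳ-≤ (suc c) (along (∁ R))))
      where
      regroup : ∀ p q a b a' b' → p * (a + a') + q * (b + b') ≡ p * a + q * b + (p * a' + q * b')
      regroup = solve-∀
      along : ∀ X → count (X ∩ V (S ∪ S')) + count (X ∩ V (S ∩ S'))
                  ≤ count (X ∩ V S) + count (X ∩ V S')
      along X = count-submodular (∩-distribˡ-∪ {X = X} (VF-∪ S S'))
        (∩-greatest {M = X ∩ V (S ∩ S')}
          (∩-monoʳ {X = X} (λ x t → ∩-elimˡ {S = V S} {S' = V S'} x (VF-∩ S S' x t)))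
          (∩-monoʳ {X = X} (λ x t → ∩-elimʳ {S = V S} {S' = V S'} x (VF-∩ S S' x t))))

    fval-mono : ∀ {S S'} → S ⊆ S' → f S ≤ f S'
    fval-mono {S} {S'} S⊆S' with nonempty-or-empty S
    ... | inj₂ S-empty = subst (_≤ f S') (sym (fval-empty S-empty)) z≤n
    ... | inj₁ (e , Se) = +-cancelʳ-≤ (suc c) (f S) (f S')
      (subst₂ _≤_ (sym (fval-shift e Se)) (sym (fval-shift e (S⊆S' e Se))) (ψ-mono S⊆S'))

    -- With a common edge all four sets are nonempty, where f is ψ shifted by a constant.
    fval-submodular : ∀ {S S'} e → T (S e) → T (S' e) → f (S ∪ S') + f (S ∩ S') ≤ f S + f S'
    fval-submodular {S} {S'} e Se S'e = +-cancelʳ-≤ (suc c + suc c) _ _ (begin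
      f (S ∪ S') + f (S ∩ S') + (suc c + suc c)    ≡⟨ interchange (f (S ∪ S')) (f (S ∩ S')) (suc c) (suc c) ⟩
      f (S ∪ S') + suc c + (f (S ∩ S') + suc c)    ≡⟨ cong₂ _+_
                                                        (fval-shift {S ∪ S'} e (∪-introˡ {S = S} {S'} e Se))
                                                        (fval-shift {S ∩ S'} e (∩-intro {S = S} {S'} Se S'e)) ⟩
      ψ (S ∪ S') + ψ (S ∩ S')                      ≤⟨ ψ-submodular S S' ⟩
      ψ S + ψ S'                                   ≡⟨ cong₂ _+_ (fval-shift e Se) (fval-shift e S'e) ⟨
      f S + suc c + (f S' + suc c)                 ≡⟨ interchange (f S) (f S') (suc c) (suc c) ⟨
      f S + f S' + (suc c + suc c)                 ∎)
      where open ≤-Reasoning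

module Partitions (d : ℕ) {n m : ℕ} (u v : Fin m → Fin n) (R : Sub n) (F : Sub m) where

  open EdgeSets d u v R using (f; fval-cong; fval-empty; Feasible)

  Partition : ℕ → Set
  Partition = Labelling d u v R F

  block : ∀ {k} → Partition k → Fin k → Sub m
  block = part d u v R {F}

  cost : ∀ {k} → Partition k → ℕ
  cost = partSum d u v R {F}

  memb-elim : ∀ {k} b (g : T b → Fin k) {j} → T (memb d u v R b g j) → Σ (T b) λ h → g h ≡ j
  memb-elim true g t = tt , toWitness t

  memb-intro : ∀ {k} b (g : T b → Fin k) (h : T b) {j} → g h ≡ j → T (memb d u v R b g j)
  memb-intro true g tt refl = subst T (sym (≡ᵇ-refl (g tt))) tt

  memb-sum : ∀ {k} b (g : T b → Fin k) w →
             sumFin (λ j → if memb d u v R b g j then w else 0) ≡ (if b then w else 0)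
  memb-sum true  g w = trans (sumFin-at (g tt) others) (cong (λ b → if b then w else 0) (≡ᵇ-refl (g tt)))
    where
    others : ∀ j → j ≢ g tt → (if g tt ≡ᵇ j then w else 0) ≡ 0
    others j j≢ rewrite ≡ᵇ-≢ (j≢ ∘ sym) = refl
  memb-sum {k} false g w = sumFin-zero {k} (λ _ → refl)

  block-elim : ∀ {k} (p : Partition k) {j e} → T (block p j e) → Σ (T (F e)) λ h → p e h ≡ j
  block-elim p {e = e} = memb-elim (F e) (p e)

  block-intro : ∀ {k} (p : Partition k) {j e} (h : T (F e)) → p e h ≡ j → T (block p j e)
  block-intro p {e = e} h = memb-intro (F e) (p e) h

  sum-block-weights : ∀ {k} (p : Partition k) w → sumFin (λ j → weight w (block p j)) ≡ weight w F
  sum-block-weights p w =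
    trans (sumFin-comm (λ j e → if block p j e then w e else 0))
          (sumFin-cong (λ e → memb-sum (F e) (p e) (w e)))

  feasible-weight≤cost : ∀ {y} → Feasible y → ∀ {k} (p : Partition k) → weight y F ≤ cost p
  feasible-weight≤cost {y} feasible p =
    subst (_≤ cost p) (sum-block-weights p y) (sumFin-mono (λ j → feasible (block p j)))

  module _ {k : ℕ} (p : Partition (suc k)) (j : Fin (suc k)) (j-empty : Empty (block p j)) where

    private
      j≢ : ∀ e h → j ≢ p e h
      j≢ e h j≡ = subst T (j-empty e) (block-intro p h (sym j≡))

    drop-block : Partition k
    drop-block e h = punchOut (j≢ e h)

    block-drop : ∀ i → block drop-block i ≐ block p (punchIn j i)
    block-drop i e = T-ext
      (λ t → let h , eq = block-elim drop-block t
             in block-intro p h (trans (sym (punchIn-punchOut (j≢ e h))) (cong (punchIn j) eq)))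
      (λ t → let h , eq = block-elim p t
             in block-intro drop-block h (punchIn-injective j _ _ (trans (punchIn-punchOut (j≢ e h)) eq)))

    cost-drop : cost drop-block ≡ cost p
    cost-drop = begin
      cost drop-block        ≡⟨ sumFin-cong (λ i → fval-cong (block-drop i)) ⟩
      rest                   ≡⟨ cong (_+ rest) (fval-empty j-empty) ⟨
      f (block p j) + rest   ≡⟨ sumFin-remove j (λ i → f (block p i)) ⟨
      cost p                 ∎
      where
      open ≡-Reasoning
      rest = sumFin (λ i → f (block p (punchIn j i)))

  nonempty-blocks : ∀ {k} (p : Partition k) →
    ∃₂ λ k' (p' : Partition k') → AllNonempty d u v R {F} p' × cost p' ≡ cost p
  nonempty-blocks {zero}  p = zero , p , (λ ()) , refl
  nonempty-blocks {suc k} p with any? (λ j → empty? (block p j))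
  ... | yes (j , j-empty) =
    let k' , p' , nonempty , cost≡ = nonempty-blocks (drop-block p j j-empty)
    in k' , p' , nonempty , trans cost≡ (cost-drop p j j-empty)
  ... | no ∄ = suc k , p , nonempty , refl
    where
    nonempty : AllNonempty d u v R {F} p
    nonempty j with nonempty-or-empty (block p j)
    ... | inj₁ (e , t) = e , block-elim p t
    ... | inj₂ j-empty = contradiction (j , j-empty) ∄

module Duality (d c : ℕ) (D≡ : D d ≡ suc c) {n m : ℕ} (u v : Fin m → Fin n) (R : Sub n)
               (bipartite : Bipartite u v R) (F : Sub m) where

  open EdgeSets d u v R
  open Submodularity c D≡ bipartite
  open Partitions d u v R F

  weight-single : ∀ y e → weight y (single d u v R e) ≡ y e
  weight-single y e = trans (sumFin-at e others) (cong (λ b → if b then y e else 0) (≡ᵇ-refl e))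
    where
    others : ∀ j → j ≢ e → (if j ≡ᵇ e then y j else 0) ≡ 0
    others j j≢e rewrite ≡ᵇ-≢ j≢e = refl

  feasible⇒≤mult : ∀ {y} → Feasible y → ∀ e → y e ≤ mult d u v R e
  feasible⇒≤mult {y} feasible e = subst (_≤ mult d u v R e) (weight-single y e) (feasible (single d u v R e))

  feasible? : ∀ y → Dec (Feasible y)
  feasible? y with all-or-counterexample (λ S → weight y S ≤? f S)
                     (λ eq → subst₂ _≤_ (weight-cong y eq) (fval-cong eq))
  ... | inj₁ feasible     = yes feasible
  ... | inj₂ (S , ¬y≤f)   = no λ feasible → ¬y≤f (feasible S)

  prefix : (Fin m → ℕ) → CSub d u v R
  prefix y e i = toℕ i <ᵇ y e

  copies : CSub d u v R → Fin m → ℕ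
  copies I e = count (I e)

  csize-prefix : ∀ {y} → Feasible y → csize d u v R (prefix y) ≡ sumFin y
  csize-prefix {y} feasible = sumFin-cong (λ e → count-prefix (y e) (feasible⇒≤mult feasible e))

  prefix-⊆ : ∀ {y} → SupportedOn y F → _⊆f∘_ d u v R (prefix y) F
  prefix-⊆ {y} supported e i t with F e in Fe
  ... | true  = tt
  ... | false = subst (λ c → T (toℕ i <ᵇ c)) (supported e Fe) t

  prefix-independent : ∀ {y} → Feasible y → Indep d u v R (prefix y)
  prefix-independent {y} feasible J J⊆ _ = ≤-trans (sumFin-mono bound) (feasible (under d u v R J))
    where
    bound : ∀ e → count (J e) ≤ (if anyFin (J e) then y e else 0)
    bound e with anyFin (J e) in J-used
    ... | true  = subst (count (J e) ≤_) (count-prefix (y e) (feasible⇒≤mult feasible e))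
                        (count-mono (J⊆ e))
    ... | false = subst (_≤ 0) (sym (count-empty {S = J e} λ i →
                    ¬T⇒≡false λ t → subst T J-used (anyFin-intro (J e) i t))) z≤n

  restrict : CSub d u v R → Sub m → CSub d u v R
  restrict I S e i = S e ∧ I e i

  csize-restrict : ∀ I S → csize d u v R (restrict I S) ≡ weight (copies I) S
  csize-restrict I S = sumFin-cong pointwise
    where
    pointwise : ∀ e → count (restrict I S e) ≡ (if S e then count (I e) else 0)
    pointwise e with S e
    ... | true  = refl
    ... | false = count-empty {S = λ i → false ∧ I e i} (λ _ → refl)

  independent⇒feasible : ∀ {I} → Indep d u v R I → Feasible (copies I)
  independent⇒feasible {I} independent S with csize d u v R (restrict I S) in size
  ... | zero  = subst (_≤ f S) (trans (sym size) (csize-restrict I S)) z≤n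
  ... | suc _ = subst (_≤ f S) (csize-restrict I S)
      (≤-trans (independent (restrict I S) restrict-⊆ (subst (0 <_) (sym size) (s≤s z≤n)))
               (fval-mono used⊆S))
    where
    restrict-⊆ : _⊆c_ d u v R (restrict I S) I
    restrict-⊆ e i = ∩-elimʳ {S = λ _ → S e} {S' = I e} i
    used⊆S : under d u v R (restrict I S) ⊆ S
    used⊆S e t = let i , t' = anyFin-elim (restrict I S e) t
                 in ∩-elimˡ {S = λ _ → S e} {S' = I e} i t'

  copies-supported : ∀ {I} → _⊆f∘_ d u v R I F → SupportedOn (copies I) F
  copies-supported {I} I⊆ e Fe = count-empty {S = I e} λ i → ¬T⇒≡false λ t → subst T Fe (I⊆ e i t)

  bump : (Fin m → ℕ) → Fin m → Fin m → ℕ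
  bump y e i = y i + (if i ≡ᵇ e then 1 else 0)

  private
    indicator-off : ∀ (e j : Fin m) → j ≢ e → (if j ≡ᵇ e then 1 else 0) ≡ 0
    indicator-off e j j≢e rewrite ≡ᵇ-≢ j≢e = refl

  weight-bump : ∀ y e S → weight (bump y e) S ≡ weight y S + (if S e then 1 else 0)
  weight-bump y e S = trans (weight-+ y (λ i → if i ≡ᵇ e then 1 else 0) S)
                            (cong (weight y S +_) (trans (sumFin-at e others) at-e))
    where
    others : ∀ j → j ≢ e → (if S j then (if j ≡ᵇ e then 1 else 0) else 0) ≡ 0
    others j j≢e rewrite ≡ᵇ-≢ j≢e with S j
    ... | true  = refl
    ... | false = refl
    at-e : (if S e then (if e ≡ᵇ e then 1 else 0) else 0) ≡ (if S e then 1 else 0)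
    at-e rewrite ≡ᵇ-refl e = refl

  sumFin-bump : ∀ y e → sumFin (bump y e) ≡ suc (sumFin y)
  sumFin-bump y e = begin
    sumFin (bump y e)                                   ≡⟨ sumFin-distrib-+ y indicator ⟩
    sumFin y + sumFin indicator                         ≡⟨ cong (sumFin y +_) (sumFin-at e (indicator-off e)) ⟩
    sumFin y + (if e ≡ᵇ e then 1 else 0)                ≡⟨ cong (λ b → sumFin y + (if b then 1 else 0))
                                                                (≡ᵇ-refl e) ⟩
    sumFin y + 1                                        ≡⟨ +-comm (sumFin y) 1 ⟩
    suc (sumFin y)                                      ∎
    where
    open ≡-Reasoning
    indicator = λ i → if i ≡ᵇ e then 1 else 0

  violation⇒tight : ∀ {y} e → Feasible y → ¬ Feasible (bump y e) → ∃ λ S → Tight y S × T (S e)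
  violation⇒tight {y} e feasible infeasible with all-or-counterexample (λ S → weight (bump y e) S ≤? f S)
                     (λ eq → subst₂ _≤_ (weight-cong (bump y e) eq) (fval-cong eq))
  ... | inj₁ feasible′ = contradiction feasible′ infeasible
  ... | inj₂ (S , ¬≤) with S e in Se | weight-bump y e S
  ...   | false | bumped = contradiction (subst (_≤ f S) (sym (trans bumped (+-identityʳ _))) (feasible S)) ¬≤
  ...   | true  | bumped = S , ≤-antisym (feasible S) f≤ , subst T (sym Se) tt
    where
    f≤ : f S ≤ weight y S
    f≤ = m<1+n⇒m≤n (subst (f S <_) (trans bumped (+-comm (weight y S) 1)) (≰⇒> ¬≤))

  record SaturatedVector : Set where
    field
      vec       : Fin m → ℕ
      feasible  : Feasible vec
      supported : SupportedOn vec F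
      saturated : ∀ e → T (F e) → ∃ λ S → Tight vec S × T (S e)

  -- Greedy: raise some coordinate in F while feasibility survives; the fuel k bounds
  -- the remaining steps, since feasible vectors stay below the multiplicities.
  saturate : ∀ k y → Feasible y → SupportedOn y F → sumFin (mult d u v R) ≤ sumFin y + k →
             SaturatedVector
  saturate k y feasible supported fuel with any? (λ e → T? (F e) ×-dec feasible? (bump y e))
  ... | no ∄ = record
    { vec = y ; feasible = feasible ; supported = supported
    ; saturated = λ e Fe → violation⇒tight e feasible (λ feasible′ → ∄ (e , Fe , feasible′)) }
  ... | yes (e , Fe , feasible′) with k
  ...   | zero  = contradiction (begin
          suc (sumFin y)         ≡⟨ sumFin-bump y e ⟨
          sumFin (bump y e)      ≤⟨ sumFin-mono (feasible⇒≤mult feasible′) ⟩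
          sumFin (mult d u v R)  ≤⟨ fuel ⟩
          sumFin y + 0           ≡⟨ +-identityʳ _ ⟩
          sumFin y               ∎) 1+n≰n
    where open ≤-Reasoning
  ...   | suc k′ =
    saturate k′ (bump y e) feasible′ supported′ (subst (sumFin (mult d u v R) ≤_) fuel≡ fuel)
    where
    supported′ : SupportedOn (bump y e) F
    supported′ e′ Fe′ rewrite supported e′ Fe′ = indicator-off e e′ (λ { refl → subst T Fe′ Fe })
    fuel≡ : sumFin y + suc k′ ≡ sumFin (bump y e) + k′
    fuel≡ = trans (+-suc (sumFin y) k′) (cong (_+ k′) (sym (sumFin-bump y e)))

  saturation : SaturatedVector
  saturation = saturate (sumFin (mult d u v R)) (λ _ → 0) zero-feasible (λ _ _ → refl)
                        (m≤n+m (sumFin (mult d u v R)) (sumFin {m} (λ _ → 0)))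
    where
    zero-feasible : Feasible (λ _ → 0)
    zero-feasible S = subst (_≤ f S) (sym (sumFin-zero {m} λ i → if-0 (S i))) z≤n
      where
      if-0 : ∀ b → (if b then 0 else 0) ≡ 0
      if-0 true  = refl
      if-0 false = refl

  module Blocks (sat : SaturatedVector) where

    open SaturatedVector sat renaming (vec to y)

    tight-∪ : ∀ {S S'} e → T (S e) → T (S' e) → Tight y S → Tight y S' → Tight y (S ∪ S')
    tight-∪ {S} {S'} e Se S'e tight tight′ =
      ≤-squeeze (feasible (S ∪ S')) (feasible (S ∩ S')) (begin
        f (S ∪ S') + f (S ∩ S')            ≤⟨ fval-submodular e Se S'e ⟩
        f S + f S'                         ≡⟨ cong₂ _+_ tight tight′ ⟨
        weight y S + weight y S'           ≡⟨ weight-modular y S S' ⟨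
        weight y (S ∪ S') + weight y (S ∩ S') ∎)
      where open ≤-Reasoning

    tight-∩F : ∀ {S} → Tight y S → Tight y (S ∩ F)
    tight-∩F {S} tight = ≤-antisym (feasible (S ∩ F)) (begin
      f (S ∩ F)           ≤⟨ fval-mono (∩-elimˡ {S = S} {S' = F}) ⟩
      f S                 ≡⟨ tight ⟨
      weight y S          ≡⟨ weight-∩-support y supported S ⟨
      weight y (S ∩ F)    ∎)
      where open ≤-Reasoning

    TightBlock : Fin m → Sub m → Set
    TightBlock e S = Tight y S × S ⊆ F × T (S e)

    tightBlock? : ∀ e S → Dec (TightBlock e S)
    tightBlock? e S = (weight y S ℕ.≟ f S) ×-dec all? (λ i → T? (S i) →-dec T? (F i)) ×-dec T? (S e)

    tightBlock-resp : ∀ e {S S'} → S ≐ S' → TightBlock e S → TightBlock e S'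
    tightBlock-resp e {S} {S'} eq (tight , S⊆F , Se) =
        trans (sym (weight-cong y eq)) (trans tight (fval-cong eq))
      , (λ i t → S⊆F i (≐⇒⊆ (≐-sym eq) i t))
      , ≐⇒⊆ eq e Se

    tightBlock-∪ : ∀ e {S S'} → TightBlock e S → TightBlock e S' → TightBlock e (S ∪ S')
    tightBlock-∪ e {S} {S'} (tight , S⊆F , Se) (tight′ , S'⊆F , S'e) =
      tight-∪ e Se S'e tight tight′ , ∪-least {S = S} {S'} S⊆F S'⊆F , ∪-introˡ {S = S} {S'} e Se

    maximal-block : ∀ e → T (F e) → ∃ λ M → TightBlock e M × ∀ V → TightBlock e V → V ⊆ M
    maximal-block e Fe =
      let S , tight , Se = saturated e Fe
      in greatest (tightBlock? e) (tightBlock-resp e) (tightBlock-∪ e)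
                  (tight-∩F tight , ∩-elimʳ {S = S} , ∩-intro {S = S} {F} Se Fe)

    maxBlock : ∀ e → T (F e) → Sub m
    maxBlock e Fe = proj₁ (maximal-block e Fe)

    maxBlock-tightBlock : ∀ {e} Fe → TightBlock e (maxBlock e Fe)
    maxBlock-tightBlock {e} Fe = proj₁ (proj₂ (maximal-block e Fe))

    maxBlock-maximal : ∀ {e} Fe V → TightBlock e V → V ⊆ maxBlock e Fe
    maxBlock-maximal {e} Fe = proj₂ (proj₂ (maximal-block e Fe))

    maxBlock-∋ : ∀ {e} Fe → T (maxBlock e Fe e)
    maxBlock-∋ Fe = proj₂ (proj₂ (maxBlock-tightBlock Fe))

    -- Two maximal blocks sharing an edge i have a tight union (by intersecting
    -- submodularity), which maximality forces to equal both.
    maxBlock-overlap-⊆ : ∀ {e e' i} Fe Fe' → T (maxBlock e Fe i) → T (maxBlock e' Fe' i) →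
                         maxBlock e Fe ⊆ maxBlock e' Fe'
    maxBlock-overlap-⊆ {e} {e'} {i} Fe Fe' Bi B'i x t =
      let tight  , B⊆F  , _    = maxBlock-tightBlock Fe
          tight′ , B'⊆F , B'e' = maxBlock-tightBlock Fe'
      in maxBlock-maximal Fe' (B ∪ B')
           ( tight-∪ i Bi B'i tight tight′
           , ∪-least {S = B} {B'} B⊆F B'⊆F
           , ∪-introʳ {S = B} {B'} e' B'e')
           x (∪-introˡ {S = B} {B'} x t)
      where
      B B' : Sub m
      B  = maxBlock e Fe
      B' = maxBlock e' Fe'

    maxBlock-overlap : ∀ {e e' i} Fe Fe' → T (maxBlock e Fe i) → T (maxBlock e' Fe' i) →
                       maxBlock e Fe ≐ maxBlock e' Fe'
    maxBlock-overlap Fe Fe' Bi B'i =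
      ⊆-antisym (maxBlock-overlap-⊆ Fe Fe' Bi B'i) (maxBlock-overlap-⊆ Fe' Fe B'i Bi)

    label : Partition m
    label e Fe = proj₁ (first-nonempty (maxBlock e Fe) (maxBlock-∋ Fe))

    first-maxBlock : ∀ {e} Fe → first (maxBlock e Fe) ≡ just (label e Fe)
    first-maxBlock {e} Fe = proj₂ (first-nonempty (maxBlock e Fe) (maxBlock-∋ Fe))

    label-∈ : ∀ {e} Fe → T (maxBlock e Fe (label e Fe))
    label-∈ {e} Fe = first-member (maxBlock e Fe) (first-maxBlock Fe)

    label-cong : ∀ {e e'} Fe Fe' → maxBlock e Fe ≐ maxBlock e' Fe' → label e Fe ≡ label e' Fe'
    label-cong Fe Fe' eq =
      just-injective (trans (sym (first-maxBlock Fe)) (trans (first-cong eq) (first-maxBlock Fe')))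

    block-label : ∀ {e₀} Fe₀ → block label (label e₀ Fe₀) ≐ maxBlock e₀ Fe₀
    block-label {e₀} Fe₀ = ⊆-antisym block⊆maxBlock maxBlock⊆block
      where
      block⊆maxBlock : block label (label e₀ Fe₀) ⊆ maxBlock e₀ Fe₀
      block⊆maxBlock e t =
        let Fe , label≡ = block-elim label t
        in maxBlock-overlap-⊆ Fe Fe₀ (label-∈ Fe)
             (subst (T ∘ maxBlock e₀ Fe₀) (sym label≡) (label-∈ Fe₀)) e (maxBlock-∋ Fe)
      maxBlock⊆block : maxBlock e₀ Fe₀ ⊆ block label (label e₀ Fe₀)
      maxBlock⊆block e t =
        let Fe = proj₁ (proj₂ (maxBlock-tightBlock Fe₀)) e t
        in block-intro label Fe (label-cong Fe Fe₀ (maxBlock-overlap Fe Fe₀ (maxBlock-∋ Fe) t))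

    block-tight : ∀ j → Tight y (block label j)
    block-tight j with nonempty-or-empty (block label j)
    ... | inj₂ empty = trans (weight-empty y empty) (sym (fval-empty empty))
    ... | inj₁ (e , t) with block-elim label t
    ...   | Fe , refl =
      trans (weight-cong y (block-label Fe))
            (trans (proj₁ (maxBlock-tightBlock Fe)) (sym (fval-cong (block-label Fe))))

    cost-label : cost label ≡ weight y F
    cost-label = trans (sumFin-cong (λ j → sym (block-tight j))) (sum-block-weights label y)

D-suc : ∀ d → D (suc d) ≡ suc (d + suc d C 2)
D-suc d = trans (sym (nCk+nC[k+1]≡[n+1]C[k+1] (suc d) 1)) (cong (_+ suc d C 2) (nC1≡n (suc d)))

lemma4p1 : (d : ℕ) → 1 ≤ d → (n m : ℕ) (u v : Fin m → Fin n) → Loopless u v →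
           (R : Sub n) → Bipartite u v R → (F : Sub m) →
           Σ ℕ (λ r → IsFhat d u v R F r × IsRank d u v R F r)
lemma4p1 zero ()
lemma4p1 (suc d) _ n m u v _ R bipartite F = weight y F , f̂-value , rank-value
  where
  open Duality (suc d) (d + suc d C 2) (D-suc d) u v R bipartite F
  open Partitions (suc d) u v R F
  open SaturatedVector saturation renaming (vec to y)
  open Blocks saturation

  f̂-value : IsFhat (suc d) u v R F (weight y F)
  f̂-value =
      (let k , p , nonempty , cost≡ = nonempty-blocks label in k , p , nonempty , trans cost≡ cost-label)
    , λ _ p _ → feasible-weight≤cost feasible p

  rank-value : IsRank (suc d) u v R F (weight y F)
  rank-value =
      ( prefix y , prefix-⊆ supported , prefix-independent feasible
      , trans (csize-prefix feasible) (sumFin≡weight-support y supported))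
    , λ I I⊆F independent → begin
        csize (suc d) u v R I  ≡⟨ sumFin≡weight-support (copies I) (copies-supported I⊆F) ⟩
        weight (copies I) F    ≤⟨ feasible-weight≤cost (independent⇒feasible independent) label ⟩
        cost label             ≡⟨ cost-label ⟩
        weight y F             ∎
    where open ≤-Reasoning
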